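{- Let $G$ be a graph and $A\subseteq V(G)$ a nonempty vertex set with $\mathrm{mim}_G(A)\le1$, and fix a chain order $<_A$ of $A$. Let $S_A,S'_A\subseteq A$ be co-cluster sets of $G$ with $S_A\equiv^{cc}_A S'_A$, and let $S_{\overline{A}}$ be any subset of $\overline{A}=V(G)\setminus A$. Then $S_A\cup S_{\overline{A}}$ is a co-cluster set of $G$ if and only if $S'_A\cup S_{\overline{A}}$ is a co-cluster set of $G$.
   Context: $\mathrm{mim}_G(A)$ is the maximum size of an induced matching among the edges of $G$ between $A$ and $V(G)\setminus A$. A cluster graph has every component complete; $S$ is a co-cluster set of $G$ if $G[S]$ is the complement of a cluster graph, i.e., $S$ induces a cluster graph in the complement $\overline{G}$. A chain order of $A$ is a strict total order $<_A$ with $v<_A w\Rightarrow N_G(v)\setminus A\subseteq N_G(w)\setminus A$; its reverse order $<_A^{\mathrm{rev}}$ satisfies $u<_A w$ iff $w<_A^{\mathrm{rev}} u$. For $S\subseteq A$, let $C_1,\dots,C_p$ be the vertex sets of the connected components of $\overline{G}[S]$, indexed so that $\mathrm{head}(C_j)<_A^{\mathrm{rev}}\mathrm{head}(C_i)$ whenever $i<j$, where $\mathrm{head}$ and $\mathrm{tail}$ denote the largest and smallest element w.r.t. $<_A^{\mathrm{rev}}$ (both $\emptyset$ for the empty set), and $C_i=\emptyset$ for $i>p$. For $S,S'\subseteq A$ with such indexed components $(C_i)$, $(C'_i)$, write $S\equiv^{cc}_A S'$ if $\mathrm{head}(C_1)=\mathrm{head}(C'_1)$, $\mathrm{tail}(C_1)=\mathrm{tail}(C'_1)$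 and $\mathrm{head}(C_2)=\mathrm{head}(C'_2)$. -}

module Defs where

open import Data.Nat using (ℕ; _≤_)
open import Data.Fin using (Fin)
open import Data.Fin.Subset using (Subset; _∈_; _∉_; _⊆_; Nonempty)
open import Data.List using (List; length)
open import Data.List.Relation.Unary.All using (All)
open import Data.List.Relation.Unary.AllPairs using (AllPairs)
open import Data.Maybe using (Maybe; just; nothing)
open import Data.Product using (_×_; _,_; ∃; ∃-syntax)
open import Data.Sum using (_⊎_)
open import Relation.Nullary using (¬_; Dec)
open import Relation.Binary.PropositionalEquality using (_≡_; _≢_)
open import Relation.Binary.Construct.Closure.ReflexiveTransitive using (Star)

record Graph (n : ℕ) : Set₁ where
  field
    E      : Fin n → Fin n → Set
    sym    : ∀ {x y} → E x y → E y x
    irrefl : ∀ {x} → ¬ E x x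
    dec    : ∀ x y → Dec (E x y)

module _ {n : ℕ} (G : Graph n) where
  open Graph G

  CrossEdge : Subset n → Fin n × Fin n → Set
  CrossEdge A (a , b) = a ∈ A × b ∉ A × E a b

  -- two distinct matching edges: disjoint endpoints, and no cross edge between them
  -- (edges inside A or inside V∖A do not belong to the bipartite graph G[A, V∖A])
  MatchCompat : Fin n × Fin n → Fin n × Fin n → Set
  MatchCompat (a , b) (a' , b') = a ≢ a' × b ≢ b' × ¬ E a b' × ¬ E a' b

  IsInducedMatchingAcross : Subset n → List (Fin n × Fin n) → Set
  IsInducedMatchingAcross A M = All (CrossEdge A) M × AllPairs MatchCompat M

  Mim≤1 : Subset n → Set
  Mim≤1 A = ∀ M → IsInducedMatchingAcross A M → length M ≤ 1

  record ChainOrder (A : Subset n) (_<_ : Fin n → Fin n → Set) : Set where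
    field
      dom    : ∀ {v w} → v < w → v ∈ A × w ∈ A
      irr    : ∀ {v} → ¬ (v < v)
      trans  : ∀ {u v w} → u < v → v < w → u < w
      total  : ∀ {v w} → v ∈ A → w ∈ A → (v < w) ⊎ (v ≡ w) ⊎ (w < v)
      chain  : ∀ {v w} → v < w → ∀ u → u ∉ A → E v u → E w u

  CoE : Subset n → Fin n → Fin n → Set
  CoE S x y = x ∈ S × y ∈ S × x ≢ y × ¬ E x y

  Conn : Subset n → Fin n → Fin n → Set
  Conn S = Star (CoE S)

  IsCoCluster : Subset n → Set
  IsCoCluster S = ∀ {x y} → Conn S x y → x ≡ y ⊎ CoE S x y

  Component : Subset n → Subset n → Set
  Component S C =
    Nonempty C × C ⊆ S
    × (∀ {x y} → x ∈ C → y ∈ C → Conn S x y)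
    × (∀ {x y} → x ∈ C → Conn S x y → y ∈ C)

  module CC (_<_ : Fin n → Fin n → Set) where
    _<rev_ : Fin n → Fin n → Set
    x <rev y = y < x

    IsHead : Subset n → Fin n → Set
    IsHead C h = h ∈ C × (∀ x → x ∈ C → x ≡ h ⊎ x <rev h)

    IsTail : Subset n → Fin n → Set
    IsTail C t = t ∈ C × (∀ x → x ∈ C → x ≡ t ⊎ t <rev x)

    First : Subset n → Subset n → Fin n → Set
    First S C h = Component S C × IsHead C h
      × (∀ D h' → Component S D → IsHead D h' → h' ≡ h ⊎ h' <rev h)

    Second : Subset n → Subset n → Fin n → Set
    Second S C h = Component S C × IsHead C h
      × ∃[ C₁ ] ∃[ h₁ ] (First S C₁ h₁ × h <rev h₁
         × (∀ D h' → Component S D → IsHead D h' → h' ≡ h₁ ⊎ h' ≡ h ⊎ h' <rev h))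

    -- head(C₁), tail(C₁), head(C₂), with nothing standing for ∅ (Cᵢ = ∅ when i > p)
    Head₁ : Subset n → Maybe (Fin n) → Set
    Head₁ S nothing  = ∀ C → ¬ Component S C
    Head₁ S (just h) = ∃[ C ] First S C h

    Tail₁ : Subset n → Maybe (Fin n) → Set
    Tail₁ S nothing  = ∀ C → ¬ Component S C
    Tail₁ S (just t) = ∃[ C ] ∃[ h ] (First S C h × IsTail C t)

    Head₂ : Subset n → Maybe (Fin n) → Set
    Head₂ S nothing  = ∀ C h → ¬ Second S C h
    Head₂ S (just h) = ∃[ C ] Second S C h

    _≡cc_ : Subset n → Subset n → Set
    S ≡cc S' = ∃[ h₁ ] ∃[ t₁ ] ∃[ h₂ ]
      ((Head₁ S h₁ × Head₁ S' h₁) × (Tail₁ S t₁ × Tail₁ S' t₁) × (Head₂ S h₂ × Head₂ S' h₂))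

-- Write h₁, t₁ for the head and tail of C₁ and h₂ for the head of C₂; since head and
-- tail are the <_A-least and <_A-greatest elements, h₁ is the least element of S_A.
-- By the chain property, a vertex u ∉ A that misses some vertex of S_A misses h₁.
-- If S_A ∪ S_Ā is co-cluster, co-adjacency through u is transitive, so such a u
-- misses exactly C₁; by the chain property again, this dichotomy is witnessed by the
-- adjacency of u to h₁, t₁ and h₂ alone. Conversely these conditions, together with
-- S_Ā ∪ {h₁} being co-cluster, make co-adjacency in S_A ∪ S_Ā transitive. Hence whether
-- S_A ∪ S_Ā is co-cluster depends on S_A only through (h₁, t₁, h₂), which ≡^cc_A fixes.

module Submission where

open import Defs
open import Data.Nat using (ℕ)
open import Data.Fin using (Fin; _≟_)
open import Data.Fin.Subset using (Subset; _∈_; _∉_; _⊆_; _∪_; ∁; ⁅_⁆; Nonempty)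
  renaming (⊥ to ∅)
open import Data.Fin.Subset.Properties
  using (_∈?_; x∈p∪q⁻; x∈p∪q⁺; x∈∁p⇒x∉p; ∉⊥; x∈⁅x⁆; x∈⁅y⁆⇒x≡y)
open import Data.Vec using (tabulate)
open import Data.Vec.Properties using (lookup∘tabulate; []=⇒lookup; lookup⇒[]=)
open import Data.List using (List; []; _∷_; allFin)
open import Data.List.Relation.Unary.Any using (here; there)
open import Data.List.Membership.Propositional using () renaming (_∈_ to _∈ₗ_)
open import Data.List.Membership.Propositional.Properties using (∈-allFin)
open import Data.Maybe using (Maybe; just; nothing; maybe)
open import Data.Product using (_×_; _,_; ∃-syntax; proj₁; proj₂)
open import Data.Sum using (_⊎_; inj₁; inj₂; map₂)
open import Data.Unit using (⊤; tt)
open import Data.Empty using (⊥)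
open import Function using (_∘_; id)
open import Function.Bundles using (_⇔_; mk⇔)
open import Function.Properties.Equivalence using () renaming (sym to ⇔-sym; trans to ⇔-trans)
open import Relation.Nullary using (¬_; Dec; yes; no; does; contradiction)
open import Relation.Nullary.Decidable using (dec-true; _×-dec_; _⊎-dec_; ¬?)
open import Relation.Unary using (Decidable)
open import Relation.Binary.PropositionalEquality
  using (_≡_; _≢_; refl; sym; trans; resp₂; isEquivalence)
open import Relation.Binary.Construct.Closure.ReflexiveTransitive using (ε; _◅_; _◅◅_)
import Relation.Binary.Construct.StrictToNonStrict as StrictToNonStrict

subsetOf : ∀ {n} {P : Fin n → Set} → Decidable P → Subset n
subsetOf P? = tabulate (does ∘ P?)

module _ {n : ℕ} {P : Fin n → Set} (P? : Decidable P) where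

  ∈-subsetOf⁺ : ∀ {x} → P x → x ∈ subsetOf P?
  ∈-subsetOf⁺ {x} px = lookup⇒[]= x _ (trans (lookup∘tabulate _ x) (dec-true (P? x) px))

  ∈-subsetOf⁻ : ∀ {x} → x ∈ subsetOf P? → P x
  ∈-subsetOf⁻ {x} x∈ with P? x | trans (sym (lookup∘tabulate (does ∘ P?) x)) ([]=⇒lookup x∈)
  ... | yes px | _  = px
  ... | no  _  | ()

module _ {n : ℕ} (G : Graph n) where
  open Graph G renaming (sym to E-sym; dec to E?)

  CoE-sym : ∀ {S x y} → CoE G S x y → CoE G S y x
  CoE-sym (x∈ , y∈ , x≢y , x≁y) = y∈ , x∈ , x≢y ∘ sym , x≁y ∘ E-sym

  CoE-transport : ∀ {S T x y} → x ∈ T → y ∈ T → CoE G S x y → CoE G T x y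
  CoE-transport x∈ y∈ (_ , _ , x≢y , x≁y) = x∈ , y∈ , x≢y , x≁y

  CoTransitive : Subset n → Set
  CoTransitive T = ∀ {x y z} → CoE G T x y → CoE G T y z → x ≡ z ⊎ CoE G T x z

  coCluster⇒coTransitive : ∀ {T} → IsCoCluster G T → CoTransitive T
  coCluster⇒coTransitive ccT xy yz = ccT (xy ◅ yz ◅ ε)

  coTransitive⇒coCluster : ∀ {T} → CoTransitive T → IsCoCluster G T
  coTransitive⇒coCluster tr ε = inj₁ refl
  coTransitive⇒coCluster tr (xy ◅ yz*) with coTransitive⇒coCluster tr yz*
  ... | inj₁ refl = inj₂ xy
  ... | inj₂ yz   = tr xy yz

  coCluster-⊆ : ∀ {T U} → U ⊆ T → IsCoCluster G T → IsCoCluster G U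
  coCluster-⊆ U⊆T ccT = coTransitive⇒coCluster λ xy@(x∈ , _) yz@(_ , z∈ , _) →
    map₂ (CoE-transport x∈ z∈) (coCluster⇒coTransitive ccT (widen xy) (widen yz))
    where
      widen : ∀ {x y} → CoE G _ x y → CoE G _ x y
      widen (x∈ , y∈ , x≢y , x≁y) = U⊆T x∈ , U⊆T y∈ , x≢y , x≁y

module _ {n : ℕ} (G : Graph n) (A : Subset n) {_<_ : Fin n → Fin n → Set} (CO : ChainOrder G A _<_) where
  open Graph G renaming (sym to E-sym; dec to E?)
  open ChainOrder CO renaming (trans to <-trans; irr to <-irrefl)
  open CC G _<_
  open StrictToNonStrict _≡_ _<_ using (_≤_)
  private module ≤ = StrictToNonStrict _≡_ _<_

  ≤-trans : ∀ {x y z} → x ≤ y → y ≤ z → x ≤ z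
  ≤-trans = ≤.trans isEquivalence (resp₂ _<_) <-trans

  <-≤-trans : ∀ {x y z} → x < y → y ≤ z → x < z
  <-≤-trans = ≤.<-≤-trans <-trans (proj₁ (resp₂ _<_))

  ≤-antisym : ∀ {x y} → x ≤ y → y ≤ x → x ≡ y
  ≤-antisym = ≤.antisym isEquivalence <-trans λ { refl → <-irrefl }

  ≤⇒≯ : ∀ {x y} → x ≤ y → ¬ y < x
  ≤⇒≯ x≤y y<x = <-irrefl (<-≤-trans y<x x≤y)

  ≤-<-total : ∀ {x y} → x ∈ A → y ∈ A → x ≤ y ⊎ y < x
  ≤-<-total x∈ y∈ with total x∈ y∈
  ... | inj₁ x<y        = inj₁ (inj₁ x<y)
  ... | inj₂ (inj₁ x≡y) = inj₁ (inj₂ x≡y)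
  ... | inj₂ (inj₂ y<x) = inj₂ y<x

  chain-≤ : ∀ {v w u} → v ≤ w → u ∉ A → E v u → E w u
  chain-≤ (inj₁ v<w) u∉A = chain v<w _ u∉A
  chain-≤ (inj₂ refl) _   = id

  minimum : ∀ {P : Fin n → Set} → Decidable P → (∀ {x} → P x → x ∈ A)
    → ∀ {x} → P x → ∃[ m ] (P m × ∀ {y} → P y → m ≤ y)
  minimum {P} P? P⊆A {x} px =
    let m , pm , m≤ = minimumOf (allFin n) in m , pm , m≤ (∈-allFin _)
    where
      minimumOf : (xs : List (Fin n)) → ∃[ m ] (P m × ∀ {y} → y ∈ₗ xs → P y → m ≤ y)
      minimumOf [] = x , px , λ ()
      minimumOf (y ∷ xs) with minimumOf xs | P? y
      ... | m , pm , m≤ | no ¬py = m , pm , λ { (here refl) py → contradiction py ¬py ; (there z∈) → m≤ z∈ }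
      ... | m , pm , m≤ | yes py with ≤-<-total (P⊆A pm) (P⊆A py)
      ...   | inj₁ m≤y = m , pm , λ { (here refl) _ → m≤y ; (there z∈) → m≤ z∈ }
      ...   | inj₂ y<m = y , py , λ { (here refl) _ → inj₂ refl ; (there z∈) pz → inj₁ (<-≤-trans y<m (m≤ z∈ pz)) }

  _≤rev_ : Fin n → Fin n → Set
  x ≤rev y = x ≡ y ⊎ x <rev y

  ≤rev⇒≥ : ∀ {x y} → x ≤rev y → y ≤ x
  ≤rev⇒≥ (inj₁ refl) = inj₂ refl
  ≤rev⇒≥ (inj₂ y<x)  = inj₁ y<x

  ≥⇒≤rev : ∀ {x y} → y ≤ x → x ≤rev y
  ≥⇒≤rev (inj₁ y<x)  = inj₂ y<x
  ≥⇒≤rev (inj₂ refl) = inj₁ refl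

  IsHead⇒≤ : ∀ {C h x} → IsHead C h → x ∈ C → h ≤ x
  IsHead⇒≤ (_ , isHead) x∈ = ≤rev⇒≥ (isHead _ x∈)

  IsTail⇒≤ : ∀ {C t x} → IsTail C t → x ∈ C → x ≤ t
  IsTail⇒≤ (_ , isTail) x∈ with isTail _ x∈
  ... | inj₁ x≡t = inj₂ x≡t
  ... | inj₂ x<t = inj₁ x<t

  MissesTail : Maybe (Fin n) → Fin n → Set
  MissesTail nothing  u = ⊥
  MissesTail (just t) u = ¬ E t u

  SeesHead : Maybe (Fin n) → Fin n → Set
  SeesHead nothing  u = ⊤
  SeesHead (just h) u = E h u

  Attaches : (h₁ t₁ h₂ : Maybe (Fin n)) → Fin n → Set
  Attaches nothing   t₁ h₂ u = ⊤
  Attaches (just h₁) t₁ h₂ u = E h₁ u ⊎ (MissesTail t₁ u × SeesHead h₂ u)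

  Compatible : (h₁ t₁ h₂ : Maybe (Fin n)) → Subset n → Set
  Compatible h₁ t₁ h₂ SĀ =
    (∀ {u} → u ∈ SĀ → Attaches h₁ t₁ h₂ u) × IsCoCluster G (SĀ ∪ maybe ⁅_⁆ ∅ h₁)

  module CoComponents (S : Subset n) (S⊆A : S ⊆ A) (ccS : IsCoCluster G S) where

    _∼_ : Fin n → Fin n → Set
    x ∼ y = x ≡ y ⊎ CoE G S x y

    _∼?_ : ∀ x y → Dec (x ∼ y)
    x ∼? y = (x ≟ y) ⊎-dec (x ∈? S ×-dec y ∈? S ×-dec ¬? (x ≟ y) ×-dec ¬? (E? x y))

    ∼⇒Conn : ∀ {x y} → x ∼ y → Conn G S x y
    ∼⇒Conn (inj₁ refl) = ε
    ∼⇒Conn (inj₂ xy)   = xy ◅ ε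

    ∼-sym : ∀ {x y} → x ∼ y → y ∼ x
    ∼-sym (inj₁ x≡y) = inj₁ (sym x≡y)
    ∼-sym (inj₂ xy)  = inj₂ (CoE-sym G xy)

    ∼-trans : ∀ {x y z} → x ∼ y → y ∼ z → x ∼ z
    ∼-trans x∼y y∼z = ccS (∼⇒Conn x∼y ◅◅ ∼⇒Conn y∼z)

    ∼-∈ : ∀ {x y} → x ∈ S → x ∼ y → y ∈ S
    ∼-∈ x∈ (inj₁ refl)         = x∈
    ∼-∈ _  (inj₂ (_ , y∈ , _)) = y∈

    component : Fin n → Subset n
    component x = subsetOf (x ∼?_)

    component-isComponent : ∀ {x} → x ∈ S → Component G S (component x)
    component-isComponent {x} x∈ =
      (x , ∈-subsetOf⁺ (x ∼?_) (inj₁ refl)) ,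
      (λ y∈ → ∼-∈ x∈ (∈-subsetOf⁻ (x ∼?_) y∈)) ,
      (λ y∈ z∈ → ∼⇒Conn (∼-trans (∼-sym (∈-subsetOf⁻ (x ∼?_) y∈)) (∈-subsetOf⁻ (x ∼?_) z∈))) ,
      (λ y∈ y⇝z → ∈-subsetOf⁺ (x ∼?_) (∼-trans (∈-subsetOf⁻ (x ∼?_) y∈) (ccS y⇝z)))

    Component⇒∼ : ∀ {C x y} → Component G S C → x ∈ C → y ∈ C → x ∼ y
    Component⇒∼ (_ , _ , connected , _) x∈ y∈ = ccS (connected x∈ y∈)

    Component-closed : ∀ {C x y} → Component G S C → x ∈ C → x ∼ y → y ∈ C
    Component-closed (_ , _ , _ , closed) x∈ x∼y = closed x∈ (∼⇒Conn x∼y)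

    component-head : ∀ {x} → x ∈ S → ∃[ h ] IsHead (component x) h
    component-head {x} x∈ =
      let h , x∼h , h≤ = minimum (x ∼?_) (S⊆A ∘ ∼-∈ x∈) (inj₁ refl)
      in h , ∈-subsetOf⁺ (x ∼?_) x∼h , λ y y∈ → ≥⇒≤rev (h≤ (∈-subsetOf⁻ (x ∼?_) y∈))

    IsHead-component⇒≤ : ∀ {x h} → IsHead (component x) h → h ≤ x
    IsHead-component⇒≤ {x} isHead = IsHead⇒≤ isHead (∈-subsetOf⁺ (x ∼?_) (inj₁ refl))

    noComponent⇒empty : (∀ C → ¬ Component G S C) → ∀ {x} → x ∉ S
    noComponent⇒empty none x∈ = none _ (component-isComponent x∈)

    First⇒∈ : ∀ {C h} → First S C h → h ∈ S
    First⇒∈ (isC , (h∈ , _) , _) = proj₁ (proj₂ isC) h∈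

    First⇒minimum : ∀ {C h w} → First S C h → w ∈ S → h ≤ w
    First⇒minimum (_ , _ , headsBelow) w∈ =
      let m , isHead = component-head w∈
      in ≤-trans (≤rev⇒≥ (headsBelow _ m (component-isComponent w∈) isHead)) (IsHead-component⇒≤ isHead)

    First-unique : ∀ {C D h h'} → First S C h → First S D h' → h ≡ h'
    First-unique F F' = ≤-antisym (First⇒minimum F (First⇒∈ F')) (First⇒minimum F' (First⇒∈ F))

    Head₁⇒∈ : ∀ {h} → Head₁ S (just h) → h ∈ S
    Head₁⇒∈ (_ , F) = First⇒∈ F

    Head₁⇒minimum : ∀ {h w} → Head₁ S (just h) → w ∈ S → h ≤ w
    Head₁⇒minimum (_ , F) = First⇒minimum F

    Tail₁⇒maximum : ∀ {h t} → Head₁ S (just h) → Tail₁ S (just t) → h ∼ t × (∀ {x} → h ∼ x → x ≤ t)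
    Tail₁⇒maximum (_ , F) (_ , _ , F'@(isC , (h∈C , _) , _) , isTail) with First-unique F F'
    ... | refl = Component⇒∼ isC h∈C (proj₁ isTail) ,
                 λ h∼x → IsTail⇒≤ isTail (Component-closed isC h∈C h∼x)

    Head₂⇒minimumOutside : ∀ {h h₂} → Head₁ S (just h) → Head₂ S (just h₂)
      → h₂ ∈ S × ¬ h ∼ h₂ × (∀ {w} → w ∈ S → ¬ h ∼ w → h₂ ≤ w)
    Head₂⇒minimumOutside {h} {h₂} (_ , F) (_ , isC , isHead , _ , _ , F₁ , h<h₂ , heads)
      with First-unique F F₁
    ... | refl = proj₁ (proj₂ isC) (proj₁ isHead) , h≁h₂ , h₂≤
      where
        h≁h₂ : ¬ h ∼ h₂
        h≁h₂ h∼h₂ = ≤⇒≯ (IsHead⇒≤ isHead (Component-closed isC (proj₁ isHead) (∼-sym h∼h₂))) h<h₂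

        h₂≤ : ∀ {w} → w ∈ S → ¬ h ∼ w → h₂ ≤ w
        h₂≤ {w} w∈ h≁w with component-head w∈
        ... | m , isHeadₘ with heads _ m (component-isComponent w∈) isHeadₘ
        ...   | inj₁ refl    = contradiction (∼-sym (∈-subsetOf⁻ (w ∼?_) (proj₁ isHeadₘ))) h≁w
        ...   | inj₂ m≤revh₂ = ≤-trans (≤rev⇒≥ m≤revh₂) (IsHead-component⇒≤ isHeadₘ)

    Head₂-nothing⇒∼ : ∀ {h w} → Head₁ S (just h) → Head₂ S nothing → w ∈ S → h ∼ w
    Head₂-nothing⇒∼ {h} {w} H₁ noSecond w∈ with h ∼? w
    ... | yes h∼w = h∼w
    ... | no  h≁w with minimum (λ x → x ∈? S ×-dec ¬? (h ∼? x)) (S⊆A ∘ proj₁) (w∈ , h≁w)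
    ...   | m , (m∈ , h≁m) , m≤ = contradiction second (noSecond (component m) m)
      where
        h<m : h < m
        h<m with Head₁⇒minimum H₁ m∈
        ... | inj₁ h<m  = h<m
        ... | inj₂ h≡m  = contradiction (inj₁ h≡m) h≁m

        m-isHead : IsHead (component m) m
        m-isHead = ∈-subsetOf⁺ (m ∼?_) (inj₁ refl) , λ y y∈ →
          let m∼y = ∈-subsetOf⁻ (m ∼?_) y∈
          in ≥⇒≤rev (m≤ (∼-∈ m∈ m∼y , λ h∼y → h≁m (∼-trans h∼y (∼-sym m∼y))))

        heads : ∀ D h' → Component G S D → IsHead D h' → h' ≡ h ⊎ h' ≤rev m
        heads D h' isC isHead with h ∼? h'
        ... | yes h∼h' = inj₁ (≤-antisym (IsHead⇒≤ isHead (Component-closed isC (proj₁ isHead) (∼-sym h∼h')))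
                                         (Head₁⇒minimum H₁ (proj₁ (proj₂ isC) (proj₁ isHead))))
        ... | no  h≁h' = inj₂ (≥⇒≤rev (m≤ (proj₁ (proj₂ isC) (proj₁ isHead) , h≁h')))

        second : Second S (component m) m
        second = component-isComponent m∈ , m-isHead , _ , h , proj₂ H₁ , h<m , heads

    MissesFirst : Fin n → Fin n → Set
    MissesFirst h u = (∀ {w} → w ∈ S → ¬ E w u → h ∼ w) × (∀ {w} → h ∼ w → ¬ E w u)

    attaches⇒seesAll⊎missesFirst : ∀ {h t₁ h₂ u} → Head₁ S (just h) → Tail₁ S t₁ → Head₂ S h₂
      → u ∉ A → Attaches (just h) t₁ h₂ u → (∀ {w} → w ∈ S → E w u) ⊎ MissesFirst h u
    attaches⇒seesAll⊎missesFirst H₁ _ _ u∉A (inj₁ hu) = inj₁ λ w∈ → chain-≤ (Head₁⇒minimum H₁ w∈) u∉A hu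
    attaches⇒seesAll⊎missesFirst {t₁ = nothing} _ _ _ _ (inj₂ (() , _))
    attaches⇒seesAll⊎missesFirst {h} {just t} {h₂} {u} H₁ T₁ H₂ u∉A (inj₂ (t≁u , seesH₂)) =
      inj₂ (inFirst h₂ H₂ seesH₂ , missesFirst)
      where
        missesFirst : ∀ {w} → h ∼ w → ¬ E w u
        missesFirst h∼w wu = t≁u (chain-≤ (proj₂ (Tail₁⇒maximum H₁ T₁) h∼w) u∉A wu)

        inFirst : ∀ h₂ → Head₂ S h₂ → SeesHead h₂ u → ∀ {w} → w ∈ S → ¬ E w u → h ∼ w
        inFirst nothing   H₂ _ w∈ _ = Head₂-nothing⇒∼ H₁ H₂ w∈
        inFirst (just h₂) H₂ h₂u {w} w∈ w≁u with h ∼? w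
        ... | yes h∼w = h∼w
        ... | no  h≁w = contradiction (chain-≤ (proj₂ (proj₂ (Head₂⇒minimumOutside H₁ H₂)) w∈ h≁w) u∉A h₂u) w≁u

    module _ (SĀ : Subset n) (SĀ⊆∁A : SĀ ⊆ ∁ A) where
      private
        T : Subset n
        T = S ∪ SĀ

        ∈T-left : ∀ {x} → x ∈ S → x ∈ T
        ∈T-left x∈ = x∈p∪q⁺ (inj₁ x∈)

        ∈T-right : ∀ {x} → x ∈ SĀ → x ∈ T
        ∈T-right x∈ = x∈p∪q⁺ (inj₂ x∈)

        SĀ⇒∉A : ∀ {u} → u ∈ SĀ → u ∉ A
        SĀ⇒∉A = x∈∁p⇒x∉p ∘ SĀ⊆∁A

        S≢SĀ : ∀ {x u} → x ∈ S → u ∈ SĀ → x ≢ u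
        S≢SĀ x∈ u∈ refl = SĀ⇒∉A u∈ (S⊆A x∈)

      coCluster⇒attaches : ∀ {h₁ t₁ h₂ u} → IsCoCluster G T
        → Head₁ S h₁ → Tail₁ S t₁ → Head₂ S h₂ → u ∈ SĀ → Attaches h₁ t₁ h₂ u
      coCluster⇒attaches {nothing} _ _ _ _ _ = tt
      coCluster⇒attaches {just h} {t₁} {h₂} {u} ccT H₁ T₁ H₂ u∈ with E? h u
      ... | yes hu  = inj₁ hu
      ... | no  h≁u = inj₂ (missesTail t₁ T₁ , seesHead h₂ H₂)
        where
          h∈ = Head₁⇒∈ H₁

          h—u : CoE G T h u
          h—u = ∈T-left h∈ , ∈T-right u∈ , S≢SĀ h∈ u∈ , h≁u

          missesTail : ∀ t₁ → Tail₁ S t₁ → MissesTail t₁ u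
          missesTail nothing T₁ = noComponent⇒empty T₁ h∈
          missesTail (just t) T₁ with proj₁ (Tail₁⇒maximum H₁ T₁)
          ... | inj₁ refl = h≁u
          ... | inj₂ h—t@(_ , t∈ , _)
            with coCluster⇒coTransitive G ccT (CoE-sym G (CoE-transport G (∈T-left h∈) (∈T-left t∈) h—t)) h—u
          ...   | inj₁ t≡u              = contradiction t≡u (S≢SĀ t∈ u∈)
          ...   | inj₂ (_ , _ , _ , t≁u) = t≁u

          seesHead : ∀ h₂ → Head₂ S h₂ → SeesHead h₂ u
          seesHead nothing   _  = tt
          seesHead (just h₂) H₂ with E? h₂ u | Head₂⇒minimumOutside H₁ H₂
          ... | yes h₂u  | _ = h₂u
          ... | no h₂≁u | h₂∈ , h≁h₂ , _ = contradiction
            (map₂ (CoE-transport G h∈ h₂∈)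
                  (coCluster⇒coTransitive G ccT h—u (CoE-sym G (∈T-left h₂∈ , ∈T-right u∈ , S≢SĀ h₂∈ u∈ , h₂≁u))))
            h≁h₂

      SĀ∪head⊆T : ∀ {h₁} → Head₁ S h₁ → SĀ ∪ maybe ⁅_⁆ ∅ h₁ ⊆ T
      SĀ∪head⊆T {h₁} H₁ x∈ with x∈p∪q⁻ SĀ (maybe ⁅_⁆ ∅ h₁) x∈
      ... | inj₁ x∈SĀ = ∈T-right x∈SĀ
      SĀ∪head⊆T {nothing} H₁ _ | inj₂ x∈∅ = contradiction x∈∅ ∉⊥
      SĀ∪head⊆T {just h}  H₁ _ | inj₂ x∈h with x∈⁅y⁆⇒x≡y h x∈h
      ... | refl = ∈T-left (Head₁⇒∈ H₁)

      coCluster⇒compatible : ∀ {h₁ t₁ h₂} → Head₁ S h₁ → Tail₁ S t₁ → Head₂ S h₂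
        → IsCoCluster G T → Compatible h₁ t₁ h₂ SĀ
      coCluster⇒compatible H₁ T₁ H₂ ccT =
        coCluster⇒attaches ccT H₁ T₁ H₂ , coCluster-⊆ G (SĀ∪head⊆T H₁) ccT

      module _ {h} (h∈ : h ∈ S) (ccU : IsCoCluster G (SĀ ∪ ⁅ h ⁆))
               (missesFirst : ∀ {u w} → u ∈ SĀ → w ∈ S → ¬ E w u → MissesFirst h u) where
        private
          U : Subset n
          U = SĀ ∪ ⁅ h ⁆

          h∈U : h ∈ U
          h∈U = x∈p∪q⁺ (inj₂ (x∈⁅x⁆ h))

          ∈U : ∀ {u} → u ∈ SĀ → u ∈ U
          ∈U u∈ = x∈p∪q⁺ (inj₁ u∈)

          headCoEdge : ∀ {u} → u ∈ SĀ → ¬ E h u → CoE G U h u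
          headCoEdge u∈ h≁u = h∈U , ∈U u∈ , S≢SĀ h∈ u∈ , h≁u

          ≁-sym : ∀ {x y} → ¬ E x y → ¬ E y x
          ≁-sym x≁y = x≁y ∘ E-sym

          misses-h : ∀ {u} → MissesFirst h u → ¬ E h u
          misses-h mf = proj₂ mf (inj₁ refl)

          SSĀ : ∀ {x y z} → x ∈ S → y ∈ S → z ∈ SĀ → CoE G T x y → CoE G T y z → CoE G T x z
          SSĀ x∈ y∈ z∈ (x∈T , _ , x≢y , x≁y) (_ , z∈T , _ , y≁z) =
            x∈T , z∈T , S≢SĀ x∈ z∈ , proj₂ mf (∼-trans (proj₁ mf y∈ y≁z) (inj₂ (y∈ , x∈ , x≢y ∘ sym , ≁-sym x≁y)))
            where mf = missesFirst z∈ y∈ y≁z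

          SĀS : ∀ {x y z} → x ∈ S → y ∈ SĀ → z ∈ S → CoE G T x y → CoE G T y z → x ≡ z ⊎ CoE G T x z
          SĀS x∈ y∈ z∈ (x∈T , _ , _ , x≁y) (_ , z∈T , _ , y≁z) =
            map₂ (CoE-transport G x∈T z∈T) (∼-trans (∼-sym (proj₁ mf x∈ x≁y)) (proj₁ mf z∈ (≁-sym y≁z)))
            where mf = missesFirst y∈ x∈ x≁y

          ĀSĀ : ∀ {x y z} → x ∈ SĀ → y ∈ S → z ∈ SĀ → CoE G T x y → CoE G T y z → x ≡ z ⊎ CoE G T x z
          ĀSĀ x∈ y∈ z∈ (x∈T , _ , _ , x≁y) (_ , z∈T , _ , y≁z) =
            map₂ (CoE-transport G x∈T z∈T) (coCluster⇒coTransitive G ccU (CoE-sym G (headCoEdge x∈ h≁x)) (headCoEdge z∈ h≁z))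
            where
              h≁x = misses-h (missesFirst x∈ y∈ (≁-sym x≁y))
              h≁z = misses-h (missesFirst z∈ y∈ y≁z)

          ĀĀS : ∀ {x y z} → x ∈ SĀ → y ∈ SĀ → z ∈ S → CoE G T x y → CoE G T y z → CoE G T x z
          ĀĀS {x} x∈ y∈ z∈ (x∈T , _ , x≢y , x≁y) (_ , z∈T , _ , y≁z) =
            x∈T , z∈T , S≢SĀ z∈ x∈ ∘ sym , λ xz → proj₂ mfx (proj₁ mfy z∈ (≁-sym y≁z)) (E-sym xz)
            where
              mfy = missesFirst y∈ z∈ (≁-sym y≁z)

              x≁h : ¬ E x h
              x≁h with coCluster⇒coTransitive G ccU (∈U x∈ , ∈U y∈ , x≢y , x≁y) (CoE-sym G (headCoEdge y∈ (misses-h mfy)))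
              ... | inj₁ x≡h               = contradiction (sym x≡h) (S≢SĀ h∈ x∈)
              ... | inj₂ (_ , _ , _ , x≁h) = x≁h

              mfx = missesFirst x∈ h∈ (≁-sym x≁h)

        coTransitive-∪ : CoTransitive G T
        coTransitive-∪ xy@(x∈T , y∈T , _) yz@(_ , z∈T , _)
          with x∈p∪q⁻ S SĀ x∈T | x∈p∪q⁻ S SĀ y∈T | x∈p∪q⁻ S SĀ z∈T
        ... | inj₁ x∈ | inj₁ y∈ | inj₁ z∈ =
          map₂ (CoE-transport G x∈T z∈T) (coCluster⇒coTransitive G ccS (restrict xy x∈ y∈) (restrict yz y∈ z∈))
          where
            restrict : ∀ {a b} → CoE G T a b → a ∈ S → b ∈ S → CoE G S a b
            restrict (_ , _ , a≢b , a≁b) a∈ b∈ = a∈ , b∈ , a≢b , a≁b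
        ... | inj₁ x∈ | inj₁ y∈ | inj₂ z∈ = inj₂ (SSĀ x∈ y∈ z∈ xy yz)
        ... | inj₂ x∈ | inj₁ y∈ | inj₁ z∈ = inj₂ (CoE-sym G (SSĀ z∈ y∈ x∈ (CoE-sym G yz) (CoE-sym G xy)))
        ... | inj₁ x∈ | inj₂ y∈ | inj₁ z∈ = SĀS x∈ y∈ z∈ xy yz
        ... | inj₂ x∈ | inj₁ y∈ | inj₂ z∈ = ĀSĀ x∈ y∈ z∈ xy yz
        ... | inj₂ x∈ | inj₂ y∈ | inj₁ z∈ = inj₂ (ĀĀS x∈ y∈ z∈ xy yz)
        ... | inj₁ x∈ | inj₂ y∈ | inj₂ z∈ = inj₂ (CoE-sym G (ĀĀS z∈ y∈ x∈ (CoE-sym G yz) (CoE-sym G xy)))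
        ... | inj₂ x∈ | inj₂ y∈ | inj₂ z∈ =
          map₂ (CoE-transport G x∈T z∈T) (coCluster⇒coTransitive G ccU (toU xy x∈ y∈) (toU yz y∈ z∈))
          where
            toU : ∀ {a b} → CoE G T a b → a ∈ SĀ → b ∈ SĀ → CoE G U a b
            toU ab a∈ b∈ = CoE-transport G (∈U a∈) (∈U b∈) ab

      compatible⇒coCluster : ∀ {h₁ t₁ h₂} → Head₁ S h₁ → Tail₁ S t₁ → Head₂ S h₂
        → Compatible h₁ t₁ h₂ SĀ → IsCoCluster G T
      compatible⇒coCluster {nothing} H₁ _ _ (_ , ccSĀ) = coCluster-⊆ G T⊆SĀ ccSĀ
        where
          T⊆SĀ : T ⊆ SĀ ∪ ∅
          T⊆SĀ x∈ with x∈p∪q⁻ S SĀ x∈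
          ... | inj₁ x∈S  = contradiction x∈S (noComponent⇒empty H₁)
          ... | inj₂ x∈SĀ = x∈p∪q⁺ (inj₁ x∈SĀ)
      compatible⇒coCluster {just h} H₁ T₁ H₂ (attaches , ccU) =
        coTransitive⇒coCluster G (coTransitive-∪ (Head₁⇒∈ H₁) ccU missesFirst)
        where
          missesFirst : ∀ {u w} → u ∈ SĀ → w ∈ S → ¬ E w u → MissesFirst h u
          missesFirst u∈ w∈ w≁u with attaches⇒seesAll⊎missesFirst H₁ T₁ H₂ (SĀ⇒∉A u∈) (attaches u∈)
          ... | inj₁ seesAll = contradiction (seesAll w∈) w≁u
          ... | inj₂ mf      = mf

      ∪-isCoCluster⇔compatible : ∀ {h₁ t₁ h₂} → Head₁ S h₁ → Tail₁ S t₁ → Head₂ S h₂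
        → IsCoCluster G T ⇔ Compatible h₁ t₁ h₂ SĀ
      ∪-isCoCluster⇔compatible H₁ T₁ H₂ =
        mk⇔ (coCluster⇒compatible H₁ T₁ H₂) (compatible⇒coCluster H₁ T₁ H₂)

lemma11 : ∀ {n : ℕ} (G : Graph n) (A : Subset n) → Nonempty A → Mim≤1 G A
    → (_<A_ : Fin n → Fin n → Set) → ChainOrder G A _<A_
    → (SA SA' SĀ : Subset n) → SA ⊆ A → SA' ⊆ A
    → IsCoCluster G SA → IsCoCluster G SA'
    → CC._≡cc_ G _<A_ SA SA'
    → SĀ ⊆ ∁ A
    → IsCoCluster G (SA ∪ SĀ) ⇔ IsCoCluster G (SA' ∪ SĀ)
lemma11 G A _ _ _<A_ CO SA SA' SĀ SA⊆A SA'⊆A ccSA ccSA'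
        (_ , _ , _ , (H₁ , H₁') , (T₁ , T₁') , (H₂ , H₂')) SĀ⊆∁A =
  ⇔-trans (CoComponents.∪-isCoCluster⇔compatible G A CO SA SA⊆A ccSA SĀ SĀ⊆∁A H₁ T₁ H₂)
          (⇔-sym (CoComponents.∪-isCoCluster⇔compatible G A CO SA' SA'⊆A ccSA' SĀ SĀ⊆∁A H₁' T₁' H₂'))
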